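{- Let $\ell$ be an odd prime, $n\ge2$, $G$ a closed subgroup of $\mathrm{GL}_2(\mathbb{Z}_\ell)$, and $G(\ell^k)$ its reduction modulo $\ell^k$. Assume $G(\ell^{n-1})$ is contained in a fixed Borel subgroup $B\subseteq\mathrm{GL}_2(\mathbb{Z}/\ell^{n-1}\mathbb{Z})$. Let $\gamma\in G(\ell^n)$ be such that its reduction in $G(\ell)$ has two distinct eigenvalues. Then there exists a Borel subgroup $B'\subseteq\mathrm{GL}_2(\mathbb{Z}/\ell^n\mathbb{Z})$ whose reduction modulo $\ell^{n-1}$ is $B$ and which contains $\gamma$.
   Context: A Borel subgroup of $\mathrm{GL}_2(\mathbb{Z}/\ell^n\mathbb{Z})$ is the stabilizer of a line $L\subseteq(\mathbb{Z}/\ell^n\mathbb{Z})^2$, i.e. a free rank one direct summand $L\cong\mathbb{Z}/\ell^n\mathbb{Z}$; in a suitable basis it is the group of upper triangular matrices. -}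

module Defs where

open import Data.Nat as ℕ using (ℕ; suc; _^_)
open import Data.Integer using (ℤ; +_; _-_; _*_; _+_; 0ℤ; 1ℤ)
open import Data.Integer.Divisibility using (_∣_)
open import Data.Product using (Σ; ∃; ∃-syntax; _×_)
open import Relation.Nullary using (¬_)
open import Function.Bundles using (_⇔_)

infix 4 _≡[_]_ _≡M[_]_ _≡V[_]_ _≈ₗ_
infixl 7 _·_
infixr 6 _⊙_

_≡[_]_ : ℤ → ℕ → ℤ → Set
a ≡[ m ] b = (+ m) ∣ (a - b)

IsUnit : ℕ → ℤ → Set
IsUnit m a = ∃[ e ] (a * e ≡[ m ] 1ℤ)

-- 2×2 integer matrices; an element of M₂(ℤ/mℤ) is represented by an
-- integer matrix, considered up to entrywise congruence mod m.

record M2 : Set where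
  constructor mat
  field
    a b c d : ℤ
open M2 public

record V2 : Set where
  constructor vec
  field
    x y : ℤ
open V2 public

_≡M[_]_ : M2 → ℕ → M2 → Set
A ≡M[ m ] B = (a A ≡[ m ] a B) × (b A ≡[ m ] b B)
            × (c A ≡[ m ] c B) × (d A ≡[ m ] d B)

_≡V[_]_ : V2 → ℕ → V2 → Set
v ≡V[ m ] w = (x v ≡[ m ] x w) × (y v ≡[ m ] y w)

I2 : M2
I2 = mat 1ℤ 0ℤ 0ℤ 1ℤ

_·_ : M2 → M2 → M2
A · B = mat (a A * a B + b A * c B) (a A * b B + b A * d B)
            (c A * a B + d A * c B) (c A * b B + d A * d B)

det : M2 → ℤ
det A = a A * d A - b A * c A

_⊙_ : M2 → V2 → V2
A ⊙ v = vec (a A * x v + b A * y v) (c A * x v + d A * y v)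

scale : ℤ → V2 → V2
scale t v = vec (t * x v) (t * y v)

InGL2 : ℕ → M2 → Set
InGL2 m A = IsUnit m (det A)

IsEigenvalue : ℕ → M2 → ℤ → Set
IsEigenvalue m A e = (a A - e) * (d A - e) - b A * c A ≡[ m ] 0ℤ

-- v generates a free rank one direct summand of (ℤ/mℤ)² iff v is
-- unimodular.
IsLineGen : ℕ → V2 → Set
IsLineGen m v = ∃[ u ] ∃[ w ] (u * x v + w * y v ≡[ m ] 1ℤ)

-- The Borel subgroup of GL₂(ℤ/mℤ) stabilising the line L = (ℤ/mℤ)·v,
-- as a predicate on (integer representatives of) matrices.
Borel : ℕ → V2 → M2 → Set
Borel m v A = InGL2 m A × ∃[ t ] ((A ⊙ v) ≡V[ m ] scale t v)

-- ℓ-adic matrices: M₂(ℤ_ℓ) = lim M₂(ℤ/ℓᵏℤ), represented by coherent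
-- sequences of integer matrices (seq k is the reduction mod ℓᵏ).

record MatZl (ℓ : ℕ) : Set where
  field
    seq : ℕ → M2
    coh : ∀ k → seq (suc k) ≡M[ ℓ ^ k ] seq k
open MatZl public

_≈ₗ_ : ∀ {ℓ} → MatZl ℓ → MatZl ℓ → Set
_≈ₗ_ {ℓ} g h = ∀ k → seq g k ≡M[ ℓ ^ k ] seq h k

red : ∀ {ℓ} → MatZl ℓ → ℕ → M2
red g k = seq g k

-- g ∈ GL₂(ℤ_ℓ) iff det g is an ℓ-adic unit iff det(g mod ℓ) is a unit mod ℓ
InGL2Zl : ∀ {ℓ} → MatZl ℓ → Set
InGL2Zl {ℓ} g = InGL2 ℓ (red g 1)

-- product and identity in M₂(ℤ_ℓ) are computed levelwise; we only need
-- them up to ≈ₗ, so we state membership of the product levelwise.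
IsProductOf : ∀ {ℓ} → MatZl ℓ → MatZl ℓ → MatZl ℓ → Set
IsProductOf {ℓ} p g h = ∀ k → seq p k ≡M[ ℓ ^ k ] (seq g k · seq h k)

IsIdentity : ∀ {ℓ} → MatZl ℓ → Set
IsIdentity {ℓ} e = ∀ k → seq e k ≡M[ ℓ ^ k ] I2

record IsClosedSubgroup (ℓ : ℕ) (G : MatZl ℓ → Set) : Set where
  field
    respects : ∀ {g h} → g ≈ₗ h → G g → G h
    inGL     : ∀ {g} → G g → InGL2Zl g
    one      : ∀ {e} → IsIdentity e → G e
    mul      : ∀ {g h p} → G g → G h → IsProductOf p g h → G p
    inv      : ∀ {g} → G g → ∃[ h ] (G h × (∀ {p} → IsProductOf p g h → IsIdentity p))
    closed   : ∀ g → (∀ k → ∃[ h ] (G h × (seq h k ≡M[ ℓ ^ k ] seq g k))) → G g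

Red : ∀ {ℓ} → (MatZl ℓ → Set) → ℕ → M2 → Set
Red {ℓ} G k A = ∃[ g ] (G g × (red g k ≡M[ ℓ ^ k ] A))

RedSet : (M2 → Set) → ℕ → M2 → Set
RedSet S m' C = ∃[ A ] (S A × (A ≡M[ m' ] C))

module Submission where

-- Put Q = ℓⁿ⁻¹, so ℓⁿ = ℓ·Q.  Let v span the line of B mod Q and (u, w) be a
-- covector with u·v ≡ 1 (mod Q); f = (−w, u) completes v to a basis.  Since
-- γ ∈ B mod Q we have γ v = t v + Q r.  For v′ = v + Q·Z·f and t′ = t + Q·s,
-- and because ℓ ∣ Q makes Q² vanish mod ℓQ, the congruence γ v′ ≡ t′ v′ (mod ℓQ)
-- reduces to the linear condition  r + Z·(γ − t) f − s·v ≡ 0 (mod ℓ).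
-- In the basis (v, f) the matrix γ is triangular mod ℓ with diagonal (t, t + μ),
-- where μ = det[v, (γ − t) f] is the eigengap; two eigenvalues distinct mod ℓ
-- make μ a unit, and Cramer's rule then solves the linear condition.
-- Conversely, every element of B mod Q lifts to the stabiliser of v′ mod Q²
-- (correct it by a rank one multiple of Q), so Borel(v′) reduces onto B.

open import Defs
open import Data.Nat using (ℕ; _^_; _≤_; _∸_)
open import Data.Nat.Primality using (Prime)
open import Data.Integer using (ℤ)
open import Data.Product using (∃-syntax; _×_)
open import Relation.Nullary using (¬_)
open import Relation.Binary.PropositionalEquality using (_≡_)
open import Function.Bundles using (_⇔_)

import Data.Nat as ℕ
open import Data.Nat using (suc; s≤s; z≤n)
open import Data.Nat.Divisibility as ℕᵈ using () renaming (_∣_ to _∣ₙ_)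
open import Data.Nat.Primality using (euclidsLemma; prime⇒irreducible)
open import Data.Nat.Coprimality using (Coprime; coprime-Bézout)
open import Data.Nat.GCD using (module Bézout)
open import Data.Integer using (+_; -_; _+_; _-_; _*_; 0ℤ; 1ℤ; ∣_∣)
open import Data.Integer.Properties
  using (+-identityˡ; +-identityʳ; +-inverseʳ; *-identityʳ; *-comm; pos-*; abs-*; +∣i∣≡i⊎+∣i∣≡-i)
open import Data.Integer.Divisibility.Signed as ℤᵈ using (divides) renaming (_∣_ to _∣ᶻ_)
open import Data.Integer.Tactic.RingSolver using (solve; solve-∀)
open import Data.List using (_∷_; [])
open import Data.Product using (_,_; proj₁; proj₂)
open import Data.Sum using (_⊎_; inj₁; inj₂)
import Data.Sum as Sum
open import Data.Empty using (⊥-elim)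
open import Function using (id; _∘_)
open import Function.Bundles using (mk⇔)
open import Relation.Binary.Bundles using (Setoid)
open import Relation.Binary.PropositionalEquality using (refl; sym; trans; cong; subst; module ≡-Reasoning)
import Relation.Binary.Reasoning.Setoid as SetoidReasoning

infix 4 _≈[_]_

-- Congruence of integers modulo m.  It wraps the defining divisibility
-- a ≡[ m ] b in a record so that a, m and b can be inferred from its type.
record _≈[_]_ (a : ℤ) (m : ℕ) (b : ℤ) : Set where
  constructor wrap
  field unwrap : a ≡[ m ] b
open _≈[_]_

≈-intro : ∀ {m a b e} → (+ m) ∣ᶻ e → a - b ≡ e → a ≈[ m ] b
≈-intro {m} m∣e a-b≡e = wrap (ℤᵈ.∣⇒∣ᵤ (subst ((+ m) ∣ᶻ_) (sym a-b≡e) m∣e))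

≈-elim : ∀ {m a b} → a ≈[ m ] b → (+ m) ∣ᶻ a - b
≈-elim a≈b = ℤᵈ.∣ᵤ⇒∣ (unwrap a≈b)

∣-zero : ∀ {m e} → e ≡ 0ℤ → (+ m) ∣ᶻ e
∣-zero e≡0 = subst (_ ∣ᶻ_) (sym e≡0) (divides 0ℤ refl)

≈-refl : ∀ {m a} → a ≈[ m ] a
≈-refl {a = a} = ≈-intro (∣-zero refl) (+-inverseʳ a)

≈-reflexive : ∀ {m a b} → a ≡ b → a ≈[ m ] b
≈-reflexive refl = ≈-refl

≈-sym : ∀ {m a b} → a ≈[ m ] b → b ≈[ m ] a
≈-sym {a = a} {b} a≈b = ≈-intro (ℤᵈ.∣m⇒∣-m (≈-elim a≈b)) (solve (a ∷ b ∷ []))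

≈-trans : ∀ {m a b c} → a ≈[ m ] b → b ≈[ m ] c → a ≈[ m ] c
≈-trans {a = a} {b} {c} a≈b b≈c =
  ≈-intro (ℤᵈ.∣m∣n⇒∣m+n (≈-elim a≈b) (≈-elim b≈c)) (solve (a ∷ b ∷ c ∷ []))

≈-setoid : ℕ → Setoid _ _
≈-setoid m = record
  { Carrier = ℤ ; _≈_ = _≈[ m ]_
  ; isEquivalence = record { refl = ≈-refl ; sym = ≈-sym ; trans = ≈-trans } }

module ≈-Reasoning (m : ℕ) = SetoidReasoning (≈-setoid m)

+-cong : ∀ {m a b c d} → a ≈[ m ] b → c ≈[ m ] d → a + c ≈[ m ] b + d
+-cong {a = a} {b} {c} {d} a≈b c≈d =
  ≈-intro (ℤᵈ.∣m∣n⇒∣m+n (≈-elim a≈b) (≈-elim c≈d)) (solve (a ∷ b ∷ c ∷ d ∷ []))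

neg-cong : ∀ {m a b} → a ≈[ m ] b → - a ≈[ m ] - b
neg-cong {a = a} {b} a≈b = ≈-intro (ℤᵈ.∣m⇒∣-m (≈-elim a≈b)) (solve (a ∷ b ∷ []))

sub-cong : ∀ {m a b c d} → a ≈[ m ] b → c ≈[ m ] d → a - c ≈[ m ] b - d
sub-cong a≈b c≈d = +-cong a≈b (neg-cong c≈d)

*-cong : ∀ {m a b c d} → a ≈[ m ] b → c ≈[ m ] d → a * c ≈[ m ] b * d
*-cong {a = a} {b} {c} {d} a≈b c≈d =
  ≈-intro (ℤᵈ.∣m∣n⇒∣m+n (ℤᵈ.∣m⇒∣m*n c (≈-elim a≈b)) (ℤᵈ.∣n⇒∣m*n b (≈-elim c≈d)))
          (solve (a ∷ b ∷ c ∷ d ∷ []))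

+-congˡ : ∀ {m b c} a → b ≈[ m ] c → a + b ≈[ m ] a + c
+-congˡ a = +-cong (≈-refl {a = a})

+-congʳ : ∀ {m a b} c → a ≈[ m ] b → a + c ≈[ m ] b + c
+-congʳ c a≈b = +-cong a≈b (≈-refl {a = c})

*-congˡ : ∀ {m b c} a → b ≈[ m ] c → a * b ≈[ m ] a * c
*-congˡ a = *-cong (≈-refl {a = a})

*-congʳ : ∀ {m a b} c → a ≈[ m ] b → a * c ≈[ m ] b * c
*-congʳ c a≈b = *-cong a≈b (≈-refl {a = c})

≈-weaken : ∀ {m n a b} → m ∣ₙ n → a ≈[ n ] b → a ≈[ m ] b
≈-weaken m∣n a≈b = wrap (ℕᵈ.∣-trans m∣n (unwrap a≈b))

≈-add-multiple : ∀ {m j} a k → (+ m) ∣ᶻ j → a + j * k ≈[ m ] a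
≈-add-multiple {j = j} a k m∣j = ≈-intro (ℤᵈ.∣m⇒∣m*n k m∣j) (solve (a ∷ j ∷ k ∷ []))

≈-quotient : ∀ {m a b} → a ≈[ m ] b → ∃[ r ] (a - b ≡ (+ m) * r)
≈-quotient {m} a≈b with ≈-elim a≈b
... | divides r a-b≡rm = r , trans a-b≡rm (*-comm r (+ m))

≈0-elim : ∀ {m a} → a ≈[ m ] 0ℤ → (+ m) ∣ᶻ a
≈0-elim {m} {a} a≈0 = subst ((+ m) ∣ᶻ_) (+-identityʳ a) (≈-elim a≈0)

≈-from-difference : ∀ {m a b} → a - b ≈[ m ] 0ℤ → a ≈[ m ] b
≈-from-difference a-b≈0 = ≈-intro (≈0-elim a-b≈0) refl

∣-* : ∀ {m n i j} → (+ m) ∣ᶻ i → (+ n) ∣ᶻ j → (+ (m ℕ.* n)) ∣ᶻ i * j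
∣-* {m} {n} {i} m∣i n∣j = subst (_∣ᶻ _) (sym (pos-* m n))
  (ℤᵈ.∣-trans (ℤᵈ.*-monoˡ-∣ (+ n) m∣i) (ℤᵈ.*-monoʳ-∣ i n∣j))

IsUnit-resp : ∀ {m n a b} → m ∣ₙ n → a ≈[ m ] b → IsUnit n b → IsUnit m a
IsUnit-resp m∣n a≈b (e , be≡1) = e , unwrap (≈-trans (*-congʳ e a≈b) (≈-weaken m∣n (wrap be≡1)))

-- Hensel's lemma for units: if a·e ≡ 1 (mod n) then a·e(2 − a·e) ≡ 1 (mod n²),
-- so an element invertible mod n is invertible modulo every divisor of n².
unit-lift : ∀ {m n} a → m ∣ₙ n ℕ.* n → IsUnit n a → IsUnit m a
unit-lift {m} {n} a m∣n² (e , ae≡1) = e * (+ 2 - a * e) , unwrap (≈-weaken m∣n² squared)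
  where
  ae-1 : (+ n) ∣ᶻ a * e - 1ℤ
  ae-1 = ≈-elim {a = a * e} {b = 1ℤ} (wrap ae≡1)
  newton : a * (e * (+ 2 - a * e)) - 1ℤ ≡ - ((a * e - 1ℤ) * (a * e - 1ℤ))
  newton = solve (a ∷ e ∷ [])
  squared : a * (e * (+ 2 - a * e)) ≈[ n ℕ.* n ] 1ℤ
  squared = ≈-intro (ℤᵈ.∣m⇒∣-m (∣-* ae-1 ae-1)) newton

≈0⇒∣ : ∀ {m x} → x ≈[ m ] 0ℤ → m ∣ₙ ∣ x ∣
≈0⇒∣ {m} {x} x≈0 = subst (λ z → m ∣ₙ ∣ z ∣) (+-identityʳ x) (unwrap x≈0)

∣⇒≈0 : ∀ {m x} → m ∣ₙ ∣ x ∣ → x ≈[ m ] 0ℤ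
∣⇒≈0 {m} {x} m∣x = wrap (subst (λ z → m ∣ₙ ∣ z ∣) (sym (+-identityʳ x)) m∣x)

prime-euclid : ∀ {p} → Prime p → ∀ x y → x * y ≈[ p ] 0ℤ → x ≈[ p ] 0ℤ ⊎ y ≈[ p ] 0ℤ
prime-euclid {p} prime-p x y xy≈0 =
  Sum.map ∣⇒≈0 ∣⇒≈0 (euclidsLemma ∣ x ∣ ∣ y ∣ prime-p (subst (p ∣ₙ_) (abs-* x y) (≈0⇒∣ xy≈0)))

bezout-inverse : ∀ {p n} → Bézout.Identity 1 p n → ∃[ e ] ((+ n) * e ≈[ p ] 1ℤ)
bezout-inverse {p} {n} (Bézout.+- a b 1+bn≡ap) = - (+ b) , ≈-intro (ℤᵈ.∣m⇒∣-m p∣ap) rearranged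
  where
  p∣ap : (+ p) ∣ᶻ + (a ℕ.* p)
  p∣ap = ℤᵈ.∣ᵤ⇒∣ (ℕᵈ.n∣m*n a)
  rearranged : (+ n) * - (+ b) - 1ℤ ≡ - (+ (a ℕ.* p))
  rearranged = begin
    (+ n) * - (+ b) - 1ℤ      ≡⟨ negate (+ n) (+ b) ⟩
    - (1ℤ + (+ b) * (+ n))    ≡⟨ cong (λ z → - (1ℤ + z)) (sym (pos-* b n)) ⟩
    - (+ (1 ℕ.+ b ℕ.* n))     ≡⟨ cong (λ z → - (+ z)) 1+bn≡ap ⟩
    - (+ (a ℕ.* p))           ∎
    where
    open ≡-Reasoning
    negate : ∀ N B → N * - B - 1ℤ ≡ - (1ℤ + B * N)
    negate N B = solve (N ∷ B ∷ [])
bezout-inverse {p} {n} (Bézout.-+ a b 1+ap≡bn) = + b , ≈-intro p∣ap rearranged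
  where
  p∣ap : (+ p) ∣ᶻ + (a ℕ.* p)
  p∣ap = ℤᵈ.∣ᵤ⇒∣ (ℕᵈ.n∣m*n a)
  rearranged : (+ n) * (+ b) - 1ℤ ≡ + (a ℕ.* p)
  rearranged = begin
    (+ n) * (+ b) - 1ℤ         ≡⟨ cong (_- 1ℤ) (*-comm (+ n) (+ b)) ⟩
    (+ b) * (+ n) - 1ℤ         ≡⟨ cong (_- 1ℤ) (sym (pos-* b n)) ⟩
    + (b ℕ.* n) - 1ℤ           ≡⟨ cong (λ z → + z - 1ℤ) (sym 1+ap≡bn) ⟩
    1ℤ + + (a ℕ.* p) - 1ℤ      ≡⟨ cancel (+ (a ℕ.* p)) ⟩
    + (a ℕ.* p)                ∎
    where
    open ≡-Reasoning
    cancel : ∀ M → 1ℤ + M - 1ℤ ≡ M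
    cancel M = solve (M ∷ [])

prime-coprime : ∀ {p n} → Prime p → ¬ (p ∣ₙ n) → Coprime p n
prime-coprime prime-p p∤n (d∣p , d∣n) with prime⇒irreducible prime-p d∣p
... | inj₁ d≡1  = d≡1
... | inj₂ refl = ⊥-elim (p∤n d∣n)

prime-inverse : ∀ {p} → Prime p → ∀ x → ¬ (x ≈[ p ] 0ℤ) → ∃[ e ] (x * e ≈[ p ] 1ℤ)
prime-inverse {p} prime-p x x≉0
  with bezout-inverse (coprime-Bézout (prime-coprime prime-p (x≉0 ∘ ∣⇒≈0))) | +∣i∣≡i⊎+∣i∣≡-i x
... | e , |x|e≈1 | inj₁ |x|≡x  = e , subst (λ z → z * e ≈[ p ] 1ℤ) |x|≡x |x|e≈1
... | e , |x|e≈1 | inj₂ |x|≡-x =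
  - e , ≈-trans (≈-reflexive (flip x e)) (subst (λ z → z * e ≈[ p ] 1ℤ) |x|≡-x |x|e≈1)
  where
  flip : ∀ x e → x * - e ≡ - x * e
  flip x e = solve (x ∷ e ∷ [])

pair : ℤ → ℤ → V2 → ℤ
pair u w v = u * x v + w * y v

cross : V2 → V2 → ℤ
cross p q = x p * y q - y p * x q

-- f = (−w, u) completes v to a basis when u·v ≡ 1, since [v f] = u·v.
complement : ℤ → ℤ → V2
complement u w = vec (- w) u

shifted : M2 → ℤ → V2 → V2
shifted A t p = vec (a A * x p + b A * y p - t * x p) (c A * x p + d A * y p - t * y p)

-- If A v ≡ t v, then in the basis (v, f) the matrix A is upper triangular
-- with diagonal (t, t + μ); μ = [v, (A − t) f] is the eigengap.
eigengap : M2 → ℤ → ℤ → ℤ → V2 → ℤ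
eigengap A t u w v = cross v (shifted A t (complement u w))

pair-cong : ∀ {m u w p q} → p ≡V[ m ] q → pair u w p ≈[ m ] pair u w q
pair-cong {u = u} {w} (p₁≡q₁ , p₂≡q₂) = +-cong (*-congˡ u (wrap p₁≡q₁)) (*-congˡ w (wrap p₂≡q₂))

IsLineGen-lift : ∀ {m n v} → m ∣ₙ n ℕ.* n → IsLineGen n v → IsLineGen m v
IsLineGen-lift {m} {n} {vec v₁ v₂} m∣n² (u , w , D≡1) = u * e , w * e , unwrap ueD+weD≈1
  where
  D = u * v₁ + w * v₂
  D-unit : IsUnit m D
  D-unit = unit-lift D m∣n² (1ℤ , unwrap (≈-trans (≈-reflexive (*-identityʳ D)) (wrap {D} D≡1)))
  e = proj₁ D-unit
  rescale : ∀ e → u * e * v₁ + w * e * v₂ ≡ (u * v₁ + w * v₂) * e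
  rescale e = solve (u ∷ w ∷ e ∷ v₁ ∷ v₂ ∷ [])
  ueD+weD≈1 : u * e * v₁ + w * e * v₂ ≈[ m ] 1ℤ
  ueD+weD≈1 = ≈-trans (≈-reflexive (rescale e)) (wrap (proj₂ D-unit))

charpoly-factor : ∀ {m u w t} A v → pair u w v ≈[ m ] 1ℤ → A ⊙ v ≡V[ m ] scale t v → ∀ κ
  → (a A - κ) * (d A - κ) - b A * c A ≈[ m ] (t - κ) * (eigengap A t u w v + (t - κ))
charpoly-factor {m} {u} {w} {t} (mat α β γ δ) (vec v₁ v₂) D≈1 (row₁ , row₂) κ = begin
  χ                                        ≡⟨ sym (*-identityʳ χ) ⟩
  χ * 1ℤ                                   ≈⟨ *-congˡ χ (≈-sym D≈1) ⟩
  χ * D                                    ≡⟨ triangular α β γ δ v₁ v₂ u w t κ ⟩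
  (t - κ) * (μ + (t - κ) * D) + (ε₁ * q₂ - ε₂ * q₁)
    ≈⟨ +-cong (*-congˡ (t - κ) (+-congˡ μ (*-congˡ (t - κ) D≈1)))
              (sub-cong (*-congʳ q₂ ε₁≈0) (*-congʳ q₁ ε₂≈0)) ⟩
  (t - κ) * (μ + (t - κ) * 1ℤ) + (0ℤ * q₂ - 0ℤ * q₁)
                                           ≡⟨ tidy (t - κ) μ q₁ q₂ ⟩
  (t - κ) * (μ + (t - κ))                  ∎
  where
  open ≈-Reasoning m
  χ = (α - κ) * (δ - κ) - β * γ
  D = u * v₁ + w * v₂
  μ = eigengap (mat α β γ δ) t u w (vec v₁ v₂)
  q₁ = (α - κ) * - w + β * u
  q₂ = γ * - w + (δ - κ) * u
  ε₁ = α * v₁ + β * v₂ - t * v₁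
  ε₂ = γ * v₁ + δ * v₂ - t * v₂
  ε₁≈0 : ε₁ ≈[ m ] 0ℤ
  ε₁≈0 = ≈-intro (≈-elim (wrap {α * v₁ + β * v₂} row₁)) (+-identityʳ ε₁)
  ε₂≈0 : ε₂ ≈[ m ] 0ℤ
  ε₂≈0 = ≈-intro (≈-elim (wrap {γ * v₁ + δ * v₂} row₂)) (+-identityʳ ε₂)
  -- det(A − κ)·[v f] = [(A − κ) v, (A − κ) f] with (A − κ) v = (t − κ) v + ε
  triangular : ∀ α β γ δ v₁ v₂ u w t κ →
    ((α - κ) * (δ - κ) - β * γ) * (u * v₁ + w * v₂)
    ≡ (t - κ) * ((v₁ * (γ * - w + δ * u - t * u) - v₂ * (α * - w + β * u - t * - w))
                 + (t - κ) * (u * v₁ + w * v₂))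
      + ((α * v₁ + β * v₂ - t * v₁) * (γ * - w + (δ - κ) * u)
         - (γ * v₁ + δ * v₂ - t * v₂) * ((α - κ) * - w + β * u))
  triangular = solve-∀
  tidy : ∀ s μ q₁ q₂ → s * (μ + s * 1ℤ) + (0ℤ * q₂ - 0ℤ * q₁) ≡ s * (μ + s)
  tidy = solve-∀

-- Two eigenvalues distinct mod a prime ℓ force the eigengap to be a unit mod ℓ:
-- if μ ≡ 0, every eigenvalue κ satisfies (t − κ)² ≡ 0, i.e. κ ≡ t.
eigengap-invertible : ∀ {ℓ u w t λ₁ λ₂} A v → Prime ℓ → pair u w v ≈[ ℓ ] 1ℤ
  → A ⊙ v ≡V[ ℓ ] scale t v → IsEigenvalue ℓ A λ₁ → IsEigenvalue ℓ A λ₂ → ¬ (λ₁ ≡[ ℓ ] λ₂)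
  → ∃[ e ] (eigengap A t u w v * e ≈[ ℓ ] 1ℤ)
eigengap-invertible {ℓ} {u} {w} {t} A v prime-ℓ D≈1 Av≡tv ev₁ ev₂ λ₁≢λ₂ =
  prime-inverse prime-ℓ μ μ≉0
  where
  μ = eigengap A t u w v
  only-t : ∀ {κ} → μ ≈[ ℓ ] 0ℤ → IsEigenvalue ℓ A κ → κ ≈[ ℓ ] t
  only-t {κ} μ≈0 ev =
    ≈-sym (≈-from-difference (Sum.[ id , id ] (prime-euclid prime-ℓ (t - κ) (t - κ) square≈0)))
    where
    open ≈-Reasoning ℓ
    square≈0 : (t - κ) * (t - κ) ≈[ ℓ ] 0ℤ
    square≈0 = begin
      (t - κ) * (t - κ)                          ≡⟨ cong ((t - κ) *_) (sym (+-identityˡ (t - κ))) ⟩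
      (t - κ) * (0ℤ + (t - κ))                   ≈⟨ *-congˡ (t - κ) (+-congʳ (t - κ) (≈-sym μ≈0)) ⟩
      (t - κ) * (μ + (t - κ))                    ≈⟨ ≈-sym (charpoly-factor {u = u} {w} {t} A v D≈1 Av≡tv κ) ⟩
      (a A - κ) * (d A - κ) - b A * c A          ≈⟨ wrap ev ⟩
      0ℤ                                         ∎
  μ≉0 : ¬ (μ ≈[ ℓ ] 0ℤ)
  μ≉0 μ≈0 = λ₁≢λ₂ (unwrap (≈-trans (only-t μ≈0 ev₁) (≈-sym (only-t μ≈0 ev₂))))

-- Cramer's rule mod m: if [v p] is invertible, r = s·v − Z·p is solvable,
-- with Z = −[v r]/[v p] and s = [r p]/[v p].
cramer : ∀ {m e} v p r → cross v p * e ≈[ m ] 1ℤ → ∃[ Z ] ∃[ s ]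
  ((x r + Z * x p - s * x v ≈[ m ] 0ℤ) × (y r + Z * y p - s * y v ≈[ m ] 0ℤ))
cramer {m} {e} (vec v₁ v₂) (vec p₁ p₂) (vec r₁ r₂) Δe≈1 =
  - ((v₁ * r₂ - v₂ * r₁) * e) , (r₁ * p₂ - r₂ * p₁) * e ,
  ≈-intro (ℤᵈ.∣n⇒∣m*n r₁ 1-Δe) first , ≈-intro (ℤᵈ.∣n⇒∣m*n r₂ 1-Δe) second
  where
  1-Δe : (+ m) ∣ᶻ 1ℤ - (v₁ * p₂ - v₂ * p₁) * e
  1-Δe = ≈-elim (≈-sym Δe≈1)
  first : r₁ + - ((v₁ * r₂ - v₂ * r₁) * e) * p₁ - (r₁ * p₂ - r₂ * p₁) * e * v₁ - 0ℤ
          ≡ r₁ * (1ℤ - (v₁ * p₂ - v₂ * p₁) * e)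
  first = solve (v₁ ∷ v₂ ∷ p₁ ∷ p₂ ∷ r₁ ∷ r₂ ∷ e ∷ [])
  second : r₂ + - ((v₁ * r₂ - v₂ * r₁) * e) * p₂ - (r₁ * p₂ - r₂ * p₁) * e * v₂ - 0ℤ
           ≡ r₂ * (1ℤ - (v₁ * p₂ - v₂ * p₁) * e)
  second = solve (v₁ ∷ v₂ ∷ p₁ ∷ p₂ ∷ r₁ ∷ r₂ ∷ e ∷ [])

≡V-refl : ∀ {m v} → v ≡V[ m ] v
≡V-refl {v = v} = unwrap (≈-refl {a = x v}) , unwrap (≈-refl {a = y v})

≡V-sym : ∀ {m v w} → v ≡V[ m ] w → w ≡V[ m ] v
≡V-sym {v = v} {w} (h₁ , h₂) = unwrap (≈-sym (wrap {x v} h₁)) , unwrap (≈-sym (wrap {y v} h₂))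

≡V-weaken : ∀ {m n v w} → m ∣ₙ n → v ≡V[ n ] w → v ≡V[ m ] w
≡V-weaken m∣n (h₁ , h₂) = ℕᵈ.∣-trans m∣n h₁ , ℕᵈ.∣-trans m∣n h₂

≡M-refl : ∀ {m A} → A ≡M[ m ] A
≡M-refl {A = A} =
  unwrap (≈-refl {a = a A}) , unwrap (≈-refl {a = b A}) ,
  unwrap (≈-refl {a = c A}) , unwrap (≈-refl {a = d A})

≡M-weaken : ∀ {m n A B} → m ∣ₙ n → A ≡M[ n ] B → A ≡M[ m ] B
≡M-weaken m∣n (h₁ , h₂ , h₃ , h₄) =
  ℕᵈ.∣-trans m∣n h₁ , ℕᵈ.∣-trans m∣n h₂ , ℕᵈ.∣-trans m∣n h₃ , ℕᵈ.∣-trans m∣n h₄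

≡M-sym : ∀ {m} A B → A ≡M[ m ] B → B ≡M[ m ] A
≡M-sym A B (h₁ , h₂ , h₃ , h₄) =
  unwrap (≈-sym (wrap {a A} h₁)) , unwrap (≈-sym (wrap {b A} h₂)) ,
  unwrap (≈-sym (wrap {c A} h₃)) , unwrap (≈-sym (wrap {d A} h₄))

≡M-trans : ∀ {m} A B C → A ≡M[ m ] B → B ≡M[ m ] C → A ≡M[ m ] C
≡M-trans A B C (h₁ , h₂ , h₃ , h₄) (k₁ , k₂ , k₃ , k₄) =
  unwrap (≈-trans (wrap {a A} h₁) (wrap {a B} k₁)) ,
  unwrap (≈-trans (wrap {b A} h₂) (wrap {b B} k₂)) ,
  unwrap (≈-trans (wrap {c A} h₃) (wrap {c B} k₃)) ,
  unwrap (≈-trans (wrap {d A} h₄) (wrap {d B} k₄))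

det-cong : ∀ {m} A B → A ≡M[ m ] B → det A ≈[ m ] det B
det-cong A B (h₁ , h₂ , h₃ , h₄) =
  sub-cong (*-cong (wrap {a A} h₁) (wrap {d A} h₄)) (*-cong (wrap {b A} h₂) (wrap {c A} h₃))

Borel-resp : ∀ {m n} v v′ A A′ → m ∣ₙ n → v ≡V[ m ] v′ → A ≡M[ m ] A′ → Borel n v A → Borel m v′ A′
Borel-resp {m} {n} (vec v₁ v₂) (vec v₁′ v₂′) (mat α β γ δ) (mat α′ β′ γ′ δ′)
  m∣n (h₁ , h₂) A≡A′@(hα , hβ , hγ , hδ) (A-unit , t , row₁ , row₂) =
  IsUnit-resp m∣n (≈-sym (det-cong (mat α β γ δ) (mat α′ β′ γ′ δ′) A≡A′)) A-unit ,
  t , unwrap (row (wrap {α} hα) (wrap {β} hβ) v₁≈ (wrap row₁))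
    , unwrap (row (wrap {γ} hγ) (wrap {δ} hδ) v₂≈ (wrap row₂))
  where
  v₁≈ : v₁ ≈[ m ] v₁′
  v₁≈ = wrap h₁
  v₂≈ : v₂ ≈[ m ] v₂′
  v₂≈ = wrap h₂
  row : ∀ {p p′ q q′ c c′} → p ≈[ m ] p′ → q ≈[ m ] q′ → c ≈[ m ] c′
      → p * v₁ + q * v₂ ≈[ n ] t * c → p′ * v₁′ + q′ * v₂′ ≈[ m ] t * c′
  row p≈ q≈ c≈ eq = ≈-trans (+-cong (*-cong (≈-sym p≈) (≈-sym v₁≈)) (*-cong (≈-sym q≈) (≈-sym v₂≈)))
                            (≈-trans (≈-weaken m∣n eq) (*-congˡ t c≈))

-- If the row (α, β) satisfies
-- α v₁ + β v₂ ≡ t c (mod m) with defect ρ, subtracting the rank one term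
-- ρ·(u, w) makes the row exact mod m², because u·v ≡ 1 (mod m).
row-correct : ∀ {m} α β v₁ v₂ u w t c → u * v₁ + w * v₂ ≈[ m ] 1ℤ → α * v₁ + β * v₂ ≈[ m ] t * c
  → (α + (α * v₁ + β * v₂ - t * c) * - u) * v₁ + (β + (α * v₁ + β * v₂ - t * c) * - w) * v₂
    ≈[ m ℕ.* m ] t * c
row-correct α β v₁ v₂ u w t c D≈1 row =
  ≈-intro (∣-* (≈-elim row) (≈-elim (≈-sym D≈1))) (solve (α ∷ β ∷ v₁ ∷ v₂ ∷ u ∷ w ∷ t ∷ c ∷ []))

Borel-lift : ∀ {m u w} C v → pair u w v ≈[ m ] 1ℤ → Borel m v C
  → ∃[ A ] (Borel (m ℕ.* m) v A × A ≡M[ m ] C)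
Borel-lift {m} {u} {w} (mat α β γ δ) (vec v₁ v₂) D≈1 (C-unit , t , row₁ , row₂) =
  A , (A-unit , t , unwrap (row-correct α β v₁ v₂ u w t v₁ D≈1 (wrap row₁))
                  , unwrap (row-correct γ δ v₁ v₂ u w t v₂ D≈1 (wrap row₂))) , A≡C
  where
  -- A = C − (ρ₁, ρ₂)ᵀ·(u, w), where ρᵢ are the row defects of C v − t v
  A = mat (α + (α * v₁ + β * v₂ - t * v₁) * - u) (β + (α * v₁ + β * v₂ - t * v₁) * - w)
          (γ + (γ * v₁ + δ * v₂ - t * v₂) * - u) (δ + (γ * v₁ + δ * v₂ - t * v₂) * - w)
  m∣ρ₁ : (+ m) ∣ᶻ α * v₁ + β * v₂ - t * v₁
  m∣ρ₁ = ≈-elim (wrap {α * v₁ + β * v₂} row₁)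
  m∣ρ₂ : (+ m) ∣ᶻ γ * v₁ + δ * v₂ - t * v₂
  m∣ρ₂ = ≈-elim (wrap {γ * v₁ + δ * v₂} row₂)
  A≡C : A ≡M[ m ] mat α β γ δ
  A≡C = unwrap (≈-add-multiple α (- u) m∣ρ₁) , unwrap (≈-add-multiple β (- w) m∣ρ₁) ,
        unwrap (≈-add-multiple γ (- u) m∣ρ₂) , unwrap (≈-add-multiple δ (- w) m∣ρ₂)
  A-unit : InGL2 (m ℕ.* m) A
  A-unit = unit-lift (det A) ℕᵈ.∣-refl (IsUnit-resp ℕᵈ.∣-refl (det-cong A (mat α β γ δ) A≡C) C-unit)

Borel-reduction : ∀ {ℓ Q u w v v′} → ℓ ∣ₙ Q → pair u w v ≈[ Q ] 1ℤ → v′ ≡V[ Q ] v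
  → ∀ C → RedSet (Borel (ℓ ℕ.* Q) v′) Q C ⇔ Borel Q v C
Borel-reduction {ℓ} {Q} {u} {w} {v} {v′} ℓ∣Q D≈1 v′≡v C = mk⇔ reduce lift
  where
  D′≈1 : pair u w v′ ≈[ Q ] 1ℤ
  D′≈1 = ≈-trans (pair-cong {u = u} {w} {v′} {v} v′≡v) D≈1
  v≡v′ : v ≡V[ Q ] v′
  v≡v′ = ≡V-sym {v = v′} {v} v′≡v
  reduce : RedSet (Borel (ℓ ℕ.* Q) v′) Q C → Borel Q v C
  reduce (A , A∈B′ , A≡C) = Borel-resp v′ v A C (ℕᵈ.n∣m*n ℓ) v′≡v A≡C A∈B′
  lift : Borel Q v C → RedSet (Borel (ℓ ℕ.* Q) v′) Q C
  lift C∈B =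
    let C∈B′ = Borel-resp v v′ C C ℕᵈ.∣-refl v≡v′ (≡M-refl {A = C}) C∈B
        A , A∈B″ , A≡C = Borel-lift {u = u} {w} C v′ D′≈1 C∈B′
    in A , Borel-resp v′ v′ A A (ℕᵈ.*-monoˡ-∣ Q ℓ∣Q) (≡V-refl {v = v′}) (≡M-refl {A = A}) A∈B″ , A≡C

-- Let ℓ ∣ Q ∣ q and let the row (α, β)
-- satisfy α v₁ + β v₂ − t c = q r.  For v′ = v + q Z f and t′ = t + q s the
-- row of A v′ − t′ v′ equals q·(r + Z((α, β)·f − t f_c) − s c) minus a multiple
-- of q², so it vanishes mod ℓQ as soon as that first-order defect vanishes mod ℓ.
row-lift : ∀ {ℓ Q} α β v₁ v₂ f₁ f₂ c fc t r Z s q → ℓ ∣ₙ Q → (+ Q) ∣ᶻ q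
  → α * v₁ + β * v₂ - t * c ≡ q * r
  → r + Z * (α * f₁ + β * f₂ - t * fc) - s * c ≈[ ℓ ] 0ℤ
  → α * (v₁ + q * (Z * f₁)) + β * (v₂ + q * (Z * f₂)) ≈[ ℓ ℕ.* Q ] (t + q * s) * (c + q * (Z * fc))
row-lift {ℓ} {Q} α β v₁ v₂ f₁ f₂ c fc t r Z s q ℓ∣Q Q∣q row defect≈0 =
  ≈-intro (ℤᵈ.∣m∣n⇒∣m-n (ℤᵈ.∣m∣n⇒∣m+n (∣-zero row-exact) first-order) second-order) expansion
  where
  ℓ∣q : (+ ℓ) ∣ᶻ q
  ℓ∣q = ℤᵈ.∣-trans (ℤᵈ.∣ᵤ⇒∣ ℓ∣Q) Q∣q
  row-exact : α * v₁ + β * v₂ - t * c - q * r ≡ 0ℤ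
  row-exact = trans (cong (_- q * r) row) (+-inverseʳ (q * r))
  first-order : (+ (ℓ ℕ.* Q)) ∣ᶻ (r + Z * (α * f₁ + β * f₂ - t * fc) - s * c) * q
  first-order = ∣-* (≈0-elim defect≈0) Q∣q
  second-order : (+ (ℓ ℕ.* Q)) ∣ᶻ q * q * (s * (Z * fc))
  second-order = ℤᵈ.∣m⇒∣m*n (s * (Z * fc)) (∣-* ℓ∣q Q∣q)
  expansion : α * (v₁ + q * (Z * f₁)) + β * (v₂ + q * (Z * f₂)) - (t + q * s) * (c + q * (Z * fc))
            ≡ α * v₁ + β * v₂ - t * c - q * r
              + (r + Z * (α * f₁ + β * f₂ - t * fc) - s * c) * q - q * q * (s * (Z * fc))
  expansion = solve (α ∷ β ∷ v₁ ∷ v₂ ∷ f₁ ∷ f₂ ∷ c ∷ fc ∷ t ∷ r ∷ Z ∷ s ∷ q ∷ [])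

-- If A v ≡ t v (mod Q) with u·v ≡ 1, ℓ ∣ Q, and the
-- eigengap is a unit mod ℓ, then some v′ ≡ v (mod Q) is an eigenvector of A
-- mod ℓQ: Cramer's rule makes the first-order defects of both rows vanish.
eigenline-lift : ∀ {ℓ Q u w t e} A v → ℓ ∣ₙ Q → A ⊙ v ≡V[ Q ] scale t v
  → eigengap A t u w v * e ≈[ ℓ ] 1ℤ
  → ∃[ v′ ] ∃[ t′ ] (v′ ≡V[ Q ] v × A ⊙ v′ ≡V[ ℓ ℕ.* Q ] scale t′ v′)
eigenline-lift {ℓ} {Q} {u} {w} {t} {e} (mat α β γ δ) (vec v₁ v₂) ℓ∣Q (row₁ , row₂) gap-unit =
  let r₁ , quot₁ = ≈-quotient (wrap {α * v₁ + β * v₂} row₁)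
      r₂ , quot₂ = ≈-quotient (wrap {γ * v₁ + δ * v₂} row₂)
      Z , s , defect₁ , defect₂ =
        cramer {ℓ} {e} (vec v₁ v₂) (shifted (mat α β γ δ) t (complement u w)) (vec r₁ r₂) gap-unit
  in vec (v₁ + + Q * (Z * - w)) (v₂ + + Q * (Z * u)) , t + + Q * s ,
     (unwrap (≈-add-multiple v₁ (Z * - w) Q∣Q) , unwrap (≈-add-multiple v₂ (Z * u) Q∣Q)) ,
     (unwrap (row-lift α β v₁ v₂ (- w) u v₁ (- w) t r₁ Z s (+ Q) ℓ∣Q Q∣Q quot₁ defect₁) ,
      unwrap (row-lift γ δ v₁ v₂ (- w) u v₂ u t r₂ Z s (+ Q) ℓ∣Q Q∣Q quot₂ defect₂))
  where
  Q∣Q : (+ Q) ∣ᶻ + Q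
  Q∣Q = ℤᵈ.∣-refl

Borel-lift-containing : ∀ {ℓ Q} → Prime ℓ → ℓ ∣ₙ Q
  → (v : V2) → IsLineGen Q v → (γ : M2) → Borel Q v γ
  → (∃[ λ₁ ] ∃[ λ₂ ] (IsEigenvalue ℓ γ λ₁ × IsEigenvalue ℓ γ λ₂ × ¬ (λ₁ ≡[ ℓ ] λ₂)))
  → ∃[ v′ ] (IsLineGen (ℓ ℕ.* Q) v′
      × (∀ C → RedSet (Borel (ℓ ℕ.* Q) v′) Q C ⇔ Borel Q v C)
      × Borel (ℓ ℕ.* Q) v′ γ)
Borel-lift-containing {ℓ} {Q} prime-ℓ ℓ∣Q v (u , w , D≡1) γ (γ-unit , t , γv≡tv)
                      (λ₁ , λ₂ , ev₁ , ev₂ , λ₁≢λ₂) =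
  let e , gap-unit = eigengap-invertible {u = u} {w} {t} {λ₁} {λ₂} γ v prime-ℓ
                       (≈-weaken ℓ∣Q D≈1) (≡V-weaken {v = γ ⊙ v} {scale t v} ℓ∣Q γv≡tv) ev₁ ev₂ λ₁≢λ₂
      v′ , t′ , v′≡v , γv′≡t′v′ = eigenline-lift {u = u} {w} {t} {e} γ v ℓ∣Q γv≡tv gap-unit
      D′≈1 = ≈-trans (pair-cong {u = u} {w} {v′} {v} v′≡v) D≈1
  in v′ , IsLineGen-lift {v = v′} ℓQ∣QQ (u , w , unwrap D′≈1) ,
     Borel-reduction {u = u} {w} {v} {v′} ℓ∣Q D≈1 v′≡v ,
     (unit-lift (det γ) ℓQ∣QQ γ-unit , t′ , γv′≡t′v′)
  where
  D≈1 : pair u w v ≈[ Q ] 1ℤ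
  D≈1 = wrap D≡1
  ℓQ∣QQ : ℓ ℕ.* Q ∣ₙ Q ℕ.* Q
  ℓQ∣QQ = ℕᵈ.*-monoˡ-∣ Q ℓ∣Q

-- The theorem: with Q = ℓⁿ⁻¹ we have ℓⁿ = ℓ·Q, and γ lies in B mod Q because
-- it reduces mod Q to the reduction of some g ∈ G.
lemma3p2 : (ℓ : ℕ) → Prime ℓ → ¬ (ℓ ≡ 2) → (n : ℕ) → 2 ≤ n
    → (G : MatZl ℓ → Set) → IsClosedSubgroup ℓ G
    → (v : V2) → IsLineGen (ℓ ^ (n ∸ 1)) v
    → (∀ C → Red G (n ∸ 1) C → Borel (ℓ ^ (n ∸ 1)) v C)
    → (γ : M2) → Red G n γ
    → (∃[ λ₁ ] ∃[ λ₂ ] (IsEigenvalue ℓ γ λ₁ × IsEigenvalue ℓ γ λ₂ × ¬ (λ₁ ≡[ ℓ ] λ₂)))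
    → ∃[ v′ ] (IsLineGen (ℓ ^ n) v′
        × (∀ C → RedSet (Borel (ℓ ^ n) v′) (ℓ ^ (n ∸ 1)) C ⇔ Borel (ℓ ^ (n ∸ 1)) v C)
        × Borel (ℓ ^ n) v′ γ)
lemma3p2 ℓ prime-ℓ _ (suc (suc k)) (s≤s (s≤s z≤n)) G _ v v-line G⊆B γ (g , g∈G , g≡γ) eigenvalues =
  Borel-lift-containing prime-ℓ (ℕᵈ.m∣m*n (ℓ ^ k)) v v-line γ γ∈B eigenvalues
  where
  Q = ℓ ^ suc k
  g≡γ-mod-Q : seq g (suc k) ≡M[ Q ] γ
  g≡γ-mod-Q = ≡M-trans (seq g (suc k)) (seq g (suc (suc k))) γ
                (≡M-sym (seq g (suc (suc k))) (seq g (suc k)) (coh g (suc k)))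
                (≡M-weaken {A = seq g (suc (suc k))} {γ} (ℕᵈ.n∣m*n ℓ) g≡γ)
  γ∈B : Borel Q v γ
  γ∈B = Borel-resp v v (seq g (suc k)) γ ℕᵈ.∣-refl (≡V-refl {v = v}) g≡γ-mod-Q
          (G⊆B (seq g (suc k)) (g , g∈G , ≡M-refl {A = seq g (suc k)}))
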